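{- For every integer $k\ge0$ there is no $3$-star $\Gamma$ with vertex set $V=\mathbb{Z}\times\{0,1,\dots,k\}$ such that the family $\{\Gamma+d: d\in\mathbb{Z}\}$ is a factorization of the complete graph $K_V$ (i.e. its members are spanning subgraphs of $K_V$ whose edge sets partition $E(K_V)$).
   Context: The countable star $S_1$ is the graph with vertex set $\mathbb{N}$ and edges $\{0,i\}$, $i\ge1$; a $3$-star is a graph isomorphic to the vertex-disjoint union of three copies of $S_1$. For a graph $\Gamma$ with vertices in $\mathbb{Z}\times\{0,\dots,k\}$ and $d\in\mathbb{Z}$, $\Gamma+d$ is obtained by replacing each vertex $(x,i)$ with $(x+d,i)$. -}

module Defs where

open import Data.Nat using (ℕ; zero; suc)
open import Data.Integer using (ℤ; _-_)
open import Data.Fin using (Fin)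
open import Data.Product using (Σ; _×_; _,_)
open import Data.Sum using (_⊎_)
open import Relation.Nullary using (¬_)
open import Relation.Binary.PropositionalEquality using (_≡_)
open import Function.Bundles using (_⤖_; Bijection)

Graph : Set → Set₁
Graph V = V → V → Set

Vtx : ℕ → Set
Vtx k = ℤ × Fin (suc k)

S₁ : Graph ℕ
S₁ m n = (m ≡ 0 × ¬ n ≡ 0) ⊎ (n ≡ 0 × ¬ m ≡ 0)

ThreeS₁ : Graph (Fin 3 × ℕ)
ThreeS₁ (a , m) (b , n) = a ≡ b × S₁ m n

record _≅_ {V W : Set} (G : Graph V) (H : Graph W) : Set₁ where
  field
    iso      : V ⤖ W
    edge-iff : ∀ u v → (G u v → H (Bijection.to iso u) (Bijection.to iso v))
                     × (H (Bijection.to iso u) (Bijection.to iso v) → G u v)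

Is3Star : {V : Set} → Graph V → Set₁
Is3Star Γ = Γ ≅ ThreeS₁

-- Translation Γ + d: vertex (x,i) ↦ (x+d,i). Edge {u,v} in Γ+d iff {u-d,v-d} in Γ.
shift : {k : ℕ} → Graph (Vtx k) → ℤ → Graph (Vtx k)
shift Γ d (x , i) (y , j) = Γ (x - d , i) (y - d , j)

-- {Γ + d : d ∈ ℤ} is a factorization of K_V: every edge {u,v} (u ≠ v) of K_V
-- lies in Γ + d for exactly one d ∈ ℤ.
IsTranslationFactorization : {k : ℕ} → Graph (Vtx k) → Set
IsTranslationFactorization {k} Γ =
  (u v : Vtx k) → ¬ u ≡ v →
    Σ ℤ (λ d → shift Γ d u v × ((d' : ℤ) → shift Γ d' u v → d' ≡ d))

{-# OPTIONS --safe #-}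
-- Translating an edge of Γ by d ≠ 0 never yields an edge of Γ, while every
-- pair of vertices is covered by a translate of some edge of Γ, one end of which
-- is a translated centre.
--
-- With at least two rows, covering {(0,i),(1,i)} shows that every row holds a
-- centre, so some centre c is alone in its row and another centre a lies in
-- a different row. The translate covering {a, c} moves a by d to a second
-- centre b of that row and c to a leaf of b; the one covering {b, c} moves b
-- back to a, hence by −d, and c to a leaf of a. Now consider the edge from c
-- to c − d: its covering translate must fix c or carry c − d to c, so it is
-- the translate by 0 or by −d, and either way it joins c to a leaf of another
-- star.
--
-- With a single row, the distance from a leaf to its centre is the length of
-- its edge, and two leaves at the same distance would give two translates of
-- one edge of Γ; so this distance is injective on leaves. It is at most
-- ∣x∣ + M, where M bounds the centres, and the 2L vertices with
-- M < ∣x∣ ≤ M + L would need 2L distinct values below 2M + L + 1.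
module Submission where

open import Defs
open import Data.Nat using (ℕ; zero; suc; _<_; _≤_; s≤s)
import Data.Nat as ℕ
import Data.Nat.Properties as ℕ
open import Data.Nat.Tactic.RingSolver using () renaming (solve-∀ to ℕ-solve-∀)
open import Data.Integer using (ℤ; +_; -[1+_]; ∣_∣; _-_; -_)
import Data.Integer.Properties as ℤ
open import Data.Integer.Tactic.RingSolver using (solve-∀)
open import Data.Fin using (Fin; toℕ; fromℕ<; splitAt; join; _≟_)
open import Data.Fin.Patterns using (0F; 1F; 2F)
import Data.Fin.Properties as Fin
open import Data.Product using (Σ; _×_; _,_; proj₁; proj₂)
open import Data.Sum using (_⊎_; inj₁; inj₂; [_,_]′; swap)
open import Data.Empty using (⊥; ⊥-elim)
open import Function using (_∘_)
open import Function.Bundles using (Bijection)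
open import Function.Definitions using (Injective)
open import Relation.Nullary using (¬_; yes; no)
open import Relation.Binary.PropositionalEquality

i-[i-j]≡j : ∀ i j → i - (i - j) ≡ j
i-[i-j]≡j = solve-∀

i-j≡k⇒j≡i-k : ∀ i {j k} → i - j ≡ k → j ≡ i - k
i-j≡k⇒j≡i-k i {j} eq = trans (sym (i-[i-j]≡j i j)) (cong (_-_ i) eq)

i-j≡i⇒j≡0 : ∀ {i j} → i - j ≡ i → j ≡ + 0
i-j≡i⇒j≡0 {i} eq = trans (i-j≡k⇒j≡i-k i eq) (ℤ.+-inverseʳ i)

i-j-k≡i⇒k≡-j : ∀ {i j k} → i - j - k ≡ i → k ≡ - j
i-j-k≡i⇒k≡-j {i} {j} eq = trans (i-j≡k⇒j≡i-k (i - j) eq) (i-j-i≡-j i j)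
  where
  i-j-i≡-j : ∀ i j → i - j - i ≡ - j
  i-j-i≡-j = solve-∀

k-[i-j]≡j-[i-k] : ∀ i j k → k - (i - j) ≡ j - (i - k)
k-[i-j]≡j-[i-k] = solve-∀

i-k≡j-l⇒k-[i-j]≡l : ∀ i j k l → i - k ≡ j - l → k - (i - j) ≡ l
i-k≡j-l⇒k-[i-j]≡l i j k l eq = begin
  k - (i - j)  ≡⟨ k-[i-j]≡j-[i-k] i j k ⟩
  j - (i - k)  ≡⟨ cong (_-_ j) eq ⟩
  j - (j - l)  ≡⟨ i-[i-j]≡j j l ⟩
  l            ∎
  where open ≡-Reasoning

i-k≡-[j-l]⇒k-[i-l]≡j : ∀ i j k l → i - k ≡ - (j - l) → k - (i - l) ≡ j
i-k≡-[j-l]⇒k-[i-l]≡j i j k l eq = begin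
  k - (i - l)    ≡⟨ k-[i-j]≡j-[i-k] i l k ⟩
  l - (i - k)    ≡⟨ cong (_-_ l) eq ⟩
  l - - (j - l)  ≡⟨ cancel j l ⟩
  j              ∎
  where
  open ≡-Reasoning
  cancel : ∀ j l → l - - (j - l) ≡ j
  cancel = solve-∀

∣i∣≡∣j∣⇒i≡j⊎i≡-j : ∀ i j → ∣ i ∣ ≡ ∣ j ∣ → i ≡ j ⊎ i ≡ - j
∣i∣≡∣j∣⇒i≡j⊎i≡-j (+ m)    (+ n)    eq = inj₁ (cong +_ eq)
∣i∣≡∣j∣⇒i≡j⊎i≡-j (+ m)    -[1+ n ] eq = inj₂ (cong +_ eq)
∣i∣≡∣j∣⇒i≡j⊎i≡-j -[1+ m ] (+ n)    eq rewrite sym eq = inj₂ refl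
∣i∣≡∣j∣⇒i≡j⊎i≡-j -[1+ m ] -[1+ n ] eq = inj₁ (cong -[1+_] (ℕ.suc-injective eq))

third-element : (a b : Fin 3) → a ≢ b → Σ (Fin 3) λ c → ∀ x → x ≢ a → x ≢ b → x ≡ c
third-element 0F 0F a≢b = ⊥-elim (a≢b refl)
third-element 1F 1F a≢b = ⊥-elim (a≢b refl)
third-element 2F 2F a≢b = ⊥-elim (a≢b refl)
third-element 0F 1F _ = 2F , λ { 0F p _ → ⊥-elim (p refl) ; 1F _ q → ⊥-elim (q refl) ; 2F _ _ → refl }
third-element 1F 0F _ = 2F , λ { 0F _ q → ⊥-elim (q refl) ; 1F p _ → ⊥-elim (p refl) ; 2F _ _ → refl }
third-element 0F 2F _ = 1F , λ { 0F p _ → ⊥-elim (p refl) ; 1F _ _ → refl ; 2F _ q → ⊥-elim (q refl) }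
third-element 2F 0F _ = 1F , λ { 0F _ q → ⊥-elim (q refl) ; 1F _ _ → refl ; 2F p _ → ⊥-elim (p refl) }
third-element 1F 2F _ = 0F , λ { 0F _ _ → refl ; 1F p _ → ⊥-elim (p refl) ; 2F _ q → ⊥-elim (q refl) }
third-element 2F 1F _ = 0F , λ { 0F _ _ → refl ; 1F _ q → ⊥-elim (q refl) ; 2F p _ → ⊥-elim (p refl) }

disjoint-injections⇒≤ : ∀ {L m} (f g : ℕ → ℕ)
  → Injective _≡_ _≡_ f → Injective _≡_ _≡_ g → (∀ i j → f i ≢ g j)
  → (∀ {i} → i < L → f i < m) → (∀ {i} → i < L → g i < m) → L ℕ.+ L ≤ m
disjoint-injections⇒≤ {L} {m} f g f-inj g-inj f≢g f< g< = Fin.injective⇒≤ combined-injective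
  where
  Bounded : (ℕ → ℕ) → Set
  Bounded f = ∀ {i} → i < L → f i < m

  restrict : (f : ℕ → ℕ) → Bounded f → Fin L → Fin m
  restrict f f< i = fromℕ< (f< (Fin.toℕ<n i))

  lower : ∀ {f g} (f< : Bounded f) (g< : Bounded g) {i j}
    → restrict f f< i ≡ restrict g g< j → f (toℕ i) ≡ g (toℕ j)
  lower _ _ eq =
    trans (sym (Fin.toℕ-fromℕ< _)) (trans (cong toℕ eq) (Fin.toℕ-fromℕ< _))

  both : Fin L ⊎ Fin L → Fin m
  both = [ restrict f f< , restrict g g< ]′

  both-injective : Injective _≡_ _≡_ both
  both-injective {inj₁ i} {inj₁ j} eq = cong inj₁ (Fin.toℕ-injective (f-inj (lower f< f< eq)))
  both-injective {inj₁ i} {inj₂ j} eq = ⊥-elim (f≢g _ _ (lower f< g< eq))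
  both-injective {inj₂ i} {inj₁ j} eq = ⊥-elim (f≢g _ _ (lower f< g< (sym eq)))
  both-injective {inj₂ i} {inj₂ j} eq = cong inj₂ (Fin.toℕ-injective (g-inj (lower g< g< eq)))

  combined-injective : Injective _≡_ _≡_ (both ∘ splitAt L)
  combined-injective {x} {y} eq = begin
    x                       ≡⟨ Fin.join-splitAt L L x ⟨
    join L L (splitAt L x)  ≡⟨ cong (join L L) (both-injective {splitAt L x} {splitAt L y} eq) ⟩
    join L L (splitAt L y)  ≡⟨ Fin.join-splitAt L L y ⟩
    y                       ∎
    where open ≡-Reasoning

translate : ∀ {k} → ℤ → Vtx k → Vtx k
translate d (x , i) = (x - d , i)

translate-zero : ∀ {k} (u : Vtx k) → translate (+ 0) u ≡ u
translate-zero (x , i) = cong (_, i) (ℤ.+-identityʳ x)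

translate-fixed⇒zero : ∀ {k d} {u : Vtx k} → translate d u ≡ u → d ≡ + 0
translate-fixed⇒zero eq = i-j≡i⇒j≡0 (cong proj₁ eq)

translate-fixes-all : ∀ {k d} {u : Vtx k} (v : Vtx k) → translate d u ≡ u → translate d v ≡ v
translate-fixes-all v eq rewrite translate-fixed⇒zero eq = translate-zero v

translate-back⇒neg : ∀ {k d e} {u : Vtx k} → translate e (translate d u) ≡ u → e ≡ - d
translate-back⇒neg eq = i-j-k≡i⇒k≡-j (cong proj₁ eq)

module TranslationFactorization
  {k : ℕ} {Γ : Graph (Vtx k)} (Γ≅3S₁ : Is3Star Γ) (factorization : IsTranslationFactorization Γ) where

  open _≅_ Γ≅3S₁
  open Bijection iso using (to; injective; strictlySurjective)

  star : Vtx k → Fin 3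
  star u = proj₁ (to u)

  Centre : Vtx k → Set
  Centre u = proj₂ (to u) ≡ 0

  centre : Fin 3 → Vtx k
  centre s = proj₁ (strictlySurjective (s , 0))

  to-centre : ∀ s → to (centre s) ≡ (s , 0)
  to-centre s = proj₂ (strictlySurjective (s , 0))

  star-centre : ∀ s → star (centre s) ≡ s
  star-centre s = cong proj₁ (to-centre s)

  centre-Centre : ∀ s → Centre (centre s)
  centre-Centre s = cong proj₂ (to-centre s)

  Centre⇒≡centre : ∀ {u} → Centre u → u ≡ centre (star u)
  Centre⇒≡centre {u} z = injective (trans (cong (star u ,_) z) (sym (to-centre (star u))))

  row : Fin 3 → Fin (suc k)
  row s = proj₂ (centre s)

  pos : Fin 3 → ℤ
  pos s = proj₁ (centre s)

  Centre⇒row : ∀ {u} → Centre u → row (star u) ≡ proj₂ u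
  Centre⇒row z = cong proj₂ (sym (Centre⇒≡centre z))

  edge⇒star : ∀ {u v} → Γ u v → star u ≡ star v
  edge⇒star e = proj₁ (proj₁ (edge-iff _ _) e)

  edge⇒S₁ : ∀ {u v} → Γ u v → (Centre u × ¬ Centre v) ⊎ (Centre v × ¬ Centre u)
  edge⇒S₁ e = proj₂ (proj₁ (edge-iff _ _) e)

  edge⇒≢ : ∀ {u v} → Γ u v → u ≢ v
  edge⇒≢ e refl with edge⇒S₁ e
  ... | inj₁ (z , ¬z) = ¬z z
  ... | inj₂ (z , ¬z) = ¬z z

  Γ-sym : ∀ {u v} → Γ u v → Γ v u
  Γ-sym e = proj₂ (edge-iff _ _) (sym (edge⇒star e) , swap (edge⇒S₁ e))

  leaf-edge : ∀ {u} → ¬ Centre u → Γ u (centre (star u))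
  leaf-edge ¬z = proj₂ (edge-iff _ _) (sym (star-centre _) , inj₂ (centre-Centre _ , ¬z))

  star-neighbour : ∀ {s w} → Γ (centre s) w → star w ≡ s
  star-neighbour e = trans (sym (edge⇒star e)) (star-centre _)

  neighbour-of-centre-is-leaf : ∀ {s w} → Γ (centre s) w → ¬ Centre w
  neighbour-of-centre-is-leaf {s} e with edge⇒S₁ e
  ... | inj₁ (_ , ¬z) = ¬z
  ... | inj₂ (_ , ¬z) = ⊥-elim (¬z (centre-Centre s))

  centres-not-adjacent : ∀ s t → ¬ Γ (centre s) (centre t)
  centres-not-adjacent s t e = neighbour-of-centre-is-leaf e (centre-Centre t)

  covering-translate : ∀ u v → u ≢ v → Σ ℤ λ d → Γ (translate d u) (translate d v)
  covering-translate u v u≢v with factorization u v u≢v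
  ... | d , e , _ = d , e

  translate-edge⇒zero : ∀ {u v d} → Γ u v → Γ (translate d u) (translate d v) → d ≡ + 0
  translate-edge⇒zero {u} {v} {d} e e′ with factorization u v (edge⇒≢ e)
  ... | _ , _ , unique = trans (unique d e′) (sym (unique (+ 0) e₀))
    where
    e₀ : Γ (translate (+ 0) u) (translate (+ 0) v)
    e₀ = subst₂ Γ (sym (translate-zero u)) (sym (translate-zero v)) e

  untranslate : ∀ {u v d} → translate d u ≡ u → Γ (translate d u) (translate d v) → Γ u v
  untranslate {v = v} fixed e = subst₂ Γ fixed (translate-fixes-all v fixed) e

  every-row-has-centre : ∀ i → Σ (Fin 3) λ s → row s ≡ i
  every-row-has-centre i with covering-translate (+ 0 , i) (+ 1 , i) (λ ())
  ... | d , e with edge⇒S₁ e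
  ... | inj₁ (z , _) = _ , Centre⇒row z
  ... | inj₂ (z , _) = _ , Centre⇒row z

  Alone : Fin 3 → Set
  Alone c = ∀ s → row s ≡ row c → s ≡ c

  alone-among-three : ∀ {s t u} → (∀ x → x ≢ s → x ≢ t → x ≡ u)
    → row t ≢ row s → row u ≢ row s → Alone s
  alone-among-three {s} {t} only-u rt≢rs ru≢rs x rx≡rs with x ≟ s | x ≟ t
  ... | yes x≡s | _       = x≡s
  ... | no _    | yes refl = ⊥-elim (rt≢rs rx≡rs)
  ... | no x≢s  | no x≢t  =
    ⊥-elim (ru≢rs (subst (λ y → row y ≡ row s) (only-u x x≢s x≢t) rx≡rs))

  alone-Centre : ∀ {c u} → Alone c → Centre u → proj₂ u ≡ row c → u ≡ centre c
  alone-Centre {u = u} alone z ru≡rc =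
    trans (Centre⇒≡centre z) (cong centre (alone (star u) (trans (Centre⇒row z) ru≡rc)))

  -- A translate fixing c or a would fix everything, making {a, c} an edge
  -- between two centres.
  partner : ∀ {a c} → Alone c → row a ≢ row c
    → Σ ℤ λ d → Σ (Fin 3) λ b → b ≢ a × translate d (centre a) ≡ centre b
                                      × Γ (centre b) (translate d (centre c))
  partner {a} {c} alone ra≢rc with covering-translate (centre a) (centre c) (ra≢rc ∘ cong proj₂)
  ... | d , e with edge⇒S₁ e
  ... | inj₂ (z , _) =
    ⊥-elim (centres-not-adjacent c a (untranslate (alone-Centre alone z refl) (Γ-sym e)))
  ... | inj₁ (z , _) = d , _ , b≢a , a↦b , subst (λ w → Γ w (translate d (centre c))) a↦b e
    where
    a↦b : translate d (centre a) ≡ centre (star (translate d (centre a)))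
    a↦b = Centre⇒≡centre z
    b≢a : star (translate d (centre a)) ≢ a
    b≢a b≡a = centres-not-adjacent a c (untranslate (trans a↦b (cong centre b≡a)) e)

  no-opposite-partners : ∀ {a b c d} → Alone c → a ≢ c → b ≢ c
    → Γ (centre b) (translate d (centre c)) → Γ (centre a) (translate (- d) (centre c)) → ⊥
  no-opposite-partners {a} {c = c} {d} alone a≢c b≢c eb ea
    with covering-translate (centre c) (translate d (centre c)) c≢w
    where
    c≢w : centre c ≢ translate d (centre c)
    c≢w c≡w = neighbour-of-centre-is-leaf eb (subst Centre c≡w (centre-Centre c))
  ... | e , g with edge⇒S₁ g
  ... | inj₁ (z , _) = b≢c (trans (sym (star-neighbour eb)) (star-neighbour (untranslate fixed g)))
    where
    fixed : translate e (centre c) ≡ centre c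
    fixed = alone-Centre alone z refl
  ... | inj₂ (z , _) = a≢c (trans (sym (star-neighbour ea′)) (star-neighbour (Γ-sym g′)))
    where
    back : translate e (translate d (centre c)) ≡ centre c
    back = alone-Centre alone z refl
    g′ : Γ (translate e (centre c)) (centre c)
    g′ = subst (Γ _) back g
    ea′ : Γ (centre a) (translate e (centre c))
    ea′ = subst (λ t → Γ (centre a) (translate t (centre c))) (sym (translate-back⇒neg back)) ea

  returning-partner : ∀ {a b c d} → Alone c → row a ≢ row c → b ≢ a
    → translate d (centre a) ≡ centre b → Γ (centre a) (translate (- d) (centre c))
  returning-partner {a} {b} {c} {d} alone ra≢rc b≢a a↦b
    with partner {b} alone (ra≢rc ∘ trans (cong proj₂ a↦b))
  ... | d′ , a′ , a′≢b , b↦a′ , ea′ =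
    subst₂ (λ s t → Γ (centre s) (translate t (centre c))) a′≡a d′≡-d ea′
    where
    ra≡rb : row a ≡ row b
    ra≡rb = cong proj₂ a↦b
    row-a⇒≢c : ∀ {x} → row x ≡ row a → x ≢ c
    row-a⇒≢c rx≡ra x≡c = ra≢rc (trans (sym rx≡ra) (cong row x≡c))
    a′≡a : a′ ≡ a
    a′≡a with third-element b c (row-a⇒≢c (sym ra≡rb))
    ... | _ , only = trans (only a′ a′≢b (row-a⇒≢c (trans (sym (cong proj₂ b↦a′)) (sym ra≡rb))))
                           (sym (only a (b≢a ∘ sym) (row-a⇒≢c refl)))
    d′≡-d : d′ ≡ - d
    d′≡-d = translate-back⇒neg (trans (cong (translate d′) a↦b) (trans b↦a′ (cong centre a′≡a)))

  no-alone-centre : ∀ {a c} → Alone c → row a ≢ row c → ⊥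
  no-alone-centre alone ra≢rc with partner alone ra≢rc
  ... | d , b , b≢a , a↦b , eb =
    no-opposite-partners alone (ra≢rc ∘ cong row) (ra≢rc ∘ trans (cong proj₂ a↦b) ∘ cong row)
      eb (returning-partner alone ra≢rc b≢a a↦b)

  distinct-rows⇒⊥ : ∀ {i j} → i ≢ j → ⊥
  distinct-rows⇒⊥ {i} {j} i≢j with every-row-has-centre i | every-row-has-centre j
  ... | s , refl | t , refl with third-element s t (i≢j ∘ cong row)
  ... | u , only-u with row u ≟ row t
  ... | yes ru≡rt =
    no-alone-centre (alone-among-three only-u (i≢j ∘ sym) (λ ru≡rs → i≢j (trans (sym ru≡rs) ru≡rt)))
      (i≢j ∘ sym)
  ... | no ru≢rt = no-alone-centre (alone-among-three (λ x p q → only-u x q p) i≢j ru≢rt) i≢j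

module SingleRow
  {Γ : Graph (Vtx 0)} (Γ≅3S₁ : Is3Star Γ) (factorization : IsTranslationFactorization Γ) where

  open TranslationFactorization Γ≅3S₁ factorization

  vertex-≡ : ∀ {u v : Vtx 0} → proj₁ u ≡ proj₁ v → u ≡ v
  vertex-≡ {_ , 0F} {_ , 0F} refl = refl

  translate-onto : ∀ (u v : Vtx 0) → translate (proj₁ u - proj₁ v) u ≡ v
  translate-onto u v = vertex-≡ (i-[i-j]≡j (proj₁ u) (proj₁ v))

  distance : Vtx 0 → ℕ
  distance w = ∣ proj₁ w - pos (star w) ∣

  -- Both cases of ∣x − c∣ = ∣x′ − c′∣ exhibit the translate of the edge {w, c}
  -- by x − x′, resp. x − c′, as the edge {w′, c′}.
  distance-injective : ∀ {w w′} → ¬ Centre w → ¬ Centre w′ → distance w ≡ distance w′ → w ≡ w′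
  distance-injective {w} {w′} leaf leaf′ eq =
    [ same-sign , opposite-sign ]′ (∣i∣≡∣j∣⇒i≡j⊎i≡-j (x - c) (x′ - c′) eq)
    where
    x x′ c c′ : ℤ
    x = proj₁ w
    x′ = proj₁ w′
    c = pos (star w)
    c′ = pos (star w′)

    same-sign : x - c ≡ x′ - c′ → w ≡ w′
    same-sign eq = vertex-≡ (ℤ.i-j≡0⇒i≡j x x′ (translate-edge⇒zero (leaf-edge leaf) moved))
      where
      moved : Γ (translate (x - x′) w) (translate (x - x′) (centre (star w)))
      moved = subst₂ Γ (sym (translate-onto w w′)) (sym (vertex-≡ (i-k≡j-l⇒k-[i-j]≡l x x′ c c′ eq)))
                     (leaf-edge leaf′)

    opposite-sign : x - c ≡ - (x′ - c′) → w ≡ w′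
    opposite-sign eq = ⊥-elim (leaf (subst Centre (sym w≡centre) (centre-Centre (star w′))))
      where
      moved : Γ (translate (x - c′) w) (translate (x - c′) (centre (star w)))
      moved = subst₂ Γ (sym (translate-onto w (centre (star w′))))
                     (sym (vertex-≡ (i-k≡-[j-l]⇒k-[i-l]≡j x x′ c c′ eq))) (Γ-sym (leaf-edge leaf′))
      w≡centre : w ≡ centre (star w′)
      w≡centre = vertex-≡ (ℤ.i-j≡0⇒i≡j x c′ (translate-edge⇒zero (leaf-edge leaf) moved))

  M : ℕ
  M = ∣ pos 0F ∣ ℕ.+ ∣ pos 1F ∣ ℕ.+ ∣ pos 2F ∣

  ∣pos∣≤M : ∀ s → ∣ pos s ∣ ≤ M
  ∣pos∣≤M 0F = ℕ.≤-trans (ℕ.m≤m+n _ _) (ℕ.m≤m+n _ _)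
  ∣pos∣≤M 1F = ℕ.≤-trans (ℕ.m≤n+m ∣ pos 1F ∣ ∣ pos 0F ∣) (ℕ.m≤m+n _ _)
  ∣pos∣≤M 2F = ℕ.m≤n+m _ _

  far⇒leaf : ∀ w → M < ∣ proj₁ w ∣ → ¬ Centre w
  far⇒leaf w M<∣w∣ z =
    ℕ.<⇒≱ M<∣w∣ (subst (λ v → ∣ proj₁ v ∣ ≤ M) (sym (Centre⇒≡centre z)) (∣pos∣≤M (star w)))

  distance≤ : ∀ w → distance w ≤ ∣ proj₁ w ∣ ℕ.+ M
  distance≤ w = ℕ.≤-trans (ℤ.∣i-j∣≤∣i∣+∣j∣ (proj₁ w) (pos (star w)))
                          (ℕ.+-monoʳ-≤ ∣ proj₁ w ∣ (∣pos∣≤M (star w)))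

  L m : ℕ
  L = suc (suc (M ℕ.+ M))
  m = suc (M ℕ.+ L ℕ.+ M)

  m<L+L : m < L ℕ.+ L
  m<L+L = ℕ.≤-trans (ℕ.≤-reflexive (cong suc (rearrange M L))) (ℕ.+-monoʳ-< L (ℕ.n<1+n _))
    where
    rearrange : ∀ M L → suc (M ℕ.+ L ℕ.+ M) ≡ L ℕ.+ suc (M ℕ.+ M)
    rearrange = ℕ-solve-∀

  module Far (v : ℕ → Vtx 0) (∣v∣ : ∀ j → ∣ proj₁ (v j) ∣ ≡ suc (M ℕ.+ j)) where

    far-leaf : ∀ j → ¬ Centre (v j)
    far-leaf j = far⇒leaf (v j) (subst (M <_) (sym (∣v∣ j)) (s≤s (ℕ.m≤m+n M j)))

    distance-injective-far : Injective _≡_ _≡_ (distance ∘ v)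
    distance-injective-far {i} {j} eq = ℕ.+-cancelˡ-≡ M _ _ (ℕ.suc-injective (begin
      suc (M ℕ.+ i)      ≡⟨ ∣v∣ i ⟨
      ∣ proj₁ (v i) ∣    ≡⟨ cong (∣_∣ ∘ proj₁) (distance-injective (far-leaf i) (far-leaf j) eq) ⟩
      ∣ proj₁ (v j) ∣    ≡⟨ ∣v∣ j ⟩
      suc (M ℕ.+ j)      ∎))
      where open ≡-Reasoning

    distance-far< : ∀ {j} → j < L → distance (v j) < m
    distance-far< {j} j<L = begin-strict
      distance (v j)           ≤⟨ distance≤ (v j) ⟩
      ∣ proj₁ (v j) ∣ ℕ.+ M    ≡⟨ cong (ℕ._+ M) (∣v∣ j) ⟩
      suc (M ℕ.+ j) ℕ.+ M      <⟨ ℕ.+-monoˡ-< M (s≤s (ℕ.+-monoʳ-< M j<L)) ⟩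
      m                        ∎
      where open ℕ.≤-Reasoning

  right left : ℕ → Vtx 0
  right j = (+ suc (M ℕ.+ j) , 0F)
  left j = (-[1+ M ℕ.+ j ] , 0F)

  open Far right (λ _ → refl) renaming
    (far-leaf to right-leaf; distance-injective-far to right-injective; distance-far< to right<)
  open Far left (λ _ → refl) renaming
    (far-leaf to left-leaf; distance-injective-far to left-injective; distance-far< to left<)

  right≢left : ∀ i j → distance (right i) ≢ distance (left j)
  right≢left i j eq with cong proj₁ (distance-injective (right-leaf i) (left-leaf j) eq)
  ... | ()

  impossible : ⊥
  impossible = ℕ.<⇒≱ m<L+L
    (disjoint-injections⇒≤ (distance ∘ right) (distance ∘ left)
      right-injective left-injective right≢left right< left<)

proposition4p6 : (k : ℕ) (Γ : Graph (Vtx k)) → ¬ (Is3Star Γ × IsTranslationFactorization Γ)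
proposition4p6 zero    Γ (Γ≅3S₁ , factorization) = SingleRow.impossible Γ≅3S₁ factorization
proposition4p6 (suc k) Γ (Γ≅3S₁ , factorization) =
  TranslationFactorization.distinct-rows⇒⊥ Γ≅3S₁ factorization {0F} {1F} (λ ())
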